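{- Let $\lambda$ be a partition and $M\in\mathrm{MLQ}(\lambda,n)$. Then $\mathrm{maj}_G(M)=\mathrm{maj}(M)$.
   Context: $\mathrm{MLQ}(\lambda,n)$: tuples $M=(B_1,\dots,B_L)$, $L=\lambda_1$, of subsets of $[n]$ with $|B_r|=\lambda'_r$, drawn with rows bottom to top and columns left to right; balls are particles, empty sites are anti-particles. $\mathrm{maj}(M)$: Ferrari–Martin labelling — for $r=L,\dots,2$, unlabelled balls of row $r$ get label $r$; balls of row $r$, by decreasing label and left to right among ties, are each paired with the first not yet labelled ball of row $r-1$ weakly to the right, cyclically (from column $n$ to column $1$), which gets the same label; a pairing wraps if the reached column is strictly smaller than the starting column; $\mathrm{maj}(M)=\sum(\ell-r+1)$ over wrapping pairings, $\ell$ the label and $r$ the starting row. $\mathrm{maj}_G$ for a generalized multiline queue $B=(B_1,\dots,B_L)$ (arbitrary subsets): every site of row $L$ gets label $L$ (particle) or $L-1$ (anti-particle). For $r=L-1,\dots,1$: let $w_1..w_n$ be the labels of row $r+1$, order columns $i_1,\dots,i_n$ with $w_{i_1}\ge\cdots\ge w_{i_n}$, ties left to right, and $s=|B_r|$. Particle phase: for $k=1..s$, site $i_k$ of row $r+1$ is paired with the first not yet labelled particle of row $r$ weakly to the right of column $i_k$, cyclically, which gets label $w_{i_k}$; this pairing wraps if the reached column is $<i_k$. Anti-particle phase: for $k=n,\dots,s+1$, site $i_k$ is paired with the first not yet labelled anti-particle of row $r$ weakly to the left of column $i_k$, cyclically, which gets label $w_{i_k}-1$; it wraps if the reached column is $>i_k$.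 Let $m_{r,\ell}$ (resp. $a_{r,\ell}$) be the number of wrapping pairings of the particle (resp. anti-particle) phase from row $r$ to row $r-1$ whose source site has label $\ell$. Then $\mathrm{maj}_G(B)=\sum_{r,\ell}(m_{r,\ell}-a_{r,\ell})(\ell-r+1)$. -}

module Defs where

open import Data.Nat as ℕ using (ℕ; zero; suc; _≤_; _∸_; _+_; _≤ᵇ_; _<ᵇ_; _≡ᵇ_)
open import Data.Nat.Properties using (_≥?_; _≤?_)
open import Data.Bool using (Bool; true; false; if_then_else_; not; _∧_)
open import Data.Maybe using (Maybe; just; nothing; is-nothing; fromMaybe)
open import Data.Product using (_×_; _,_; proj₁; proj₂; Σ)
open import Data.List as List using (List; []; _∷_; _++_; length; filter; map; upTo; reverse; take; drop; zip; foldl)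
open import Data.List.Relation.Unary.All using (All)
open import Data.List.Relation.Unary.Linked using (Linked)
open import Data.Integer as ℤ using (ℤ; +_)
open import Data.Vec as Vec using (Vec)
open import Data.Fin using (Fin; toℕ)
open import Data.Fin.Subset using (Subset; ∣_∣)
open import Relation.Binary.PropositionalEquality using (_≡_)

record Partition : Set where
  field
    parts      : List ℕ
    positive   : All (λ x → 1 ≤ x) parts
    decreasing : Linked ℕ._≥_ parts
open Partition public

largestPart : Partition → ℕ
largestPart p with parts p
... | []    = 0
... | x ∷ _ = x

conjPart : Partition → ℕ → ℕ
conjPart p r = length (filter (λ x → r ≤? x) (parts p))

-- M ∈ MLQ(λ,n): M = (B₁,…,B_L), L = λ₁, B_r ⊆ [n] with |B_r| = λ'_r.
-- Row r (1-based) is  Vec.lookup M i  with  r = toℕ i + 1.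
-- A subset of [n] is a Subset n = Vec Bool n (true = ball/particle).
IsMLQ : (p : Partition) (n : ℕ) → Vec (Subset n) (largestPart p) → Set
IsMLQ p n M = ∀ (i : Fin (largestPart p)) → ∣ Vec.lookup M i ∣ ≡ conjPart p (suc (toℕ i))

-- Generic helpers (columns are 0-based here: column c here = column c+1
-- in the paper; all comparisons are order preserving).

at : {A : Set} → A → List A → ℕ → A
at d []       _       = d
at d (x ∷ xs) zero    = x
at d (x ∷ xs) (suc i) = at d xs i

setAt : {A : Set} → List A → ℕ → A → List A
setAt []       _       _ = []
setAt (x ∷ xs) zero    y = y ∷ xs
setAt (x ∷ xs) (suc i) y = x ∷ setAt xs i y

firstSuch : (ℕ → Bool) → List ℕ → Maybe ℕ
firstSuch P []       = nothing
firstSuch P (j ∷ js) = if P j then just j else firstSuch P js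

-- columns c, c+1, …, n-1, 0, …, c-1  (weakly right, cyclically)
cycRight : ℕ → ℕ → List ℕ
cycRight n c = map (λ k → c + k) (upTo (n ∸ c)) ++ upTo c

-- columns c, c-1, …, 0, n-1, …, c+1  (weakly left, cyclically)
cycLeft : ℕ → ℕ → List ℕ
cycLeft n c = reverse (upTo (suc c)) ++ reverse (map (λ k → suc c + k) (upTo (n ∸ suc c)))

-- Stable sort of (column, label) pairs by decreasing label; ties keep
-- the input (left-to-right) order.
insDesc : ℕ × ℕ → List (ℕ × ℕ) → List (ℕ × ℕ)
insDesc p []       = p ∷ []
insDesc p (q ∷ qs) = if proj₂ p ≤ᵇ proj₂ q then q ∷ insDesc p qs else p ∷ q ∷ qs

sortDesc : List (ℕ × ℕ) → List (ℕ × ℕ)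
sortDesc = foldl (λ acc p → insDesc p acc) []

countTrue : List Bool → ℕ
countTrue []           = 0
countTrue (true ∷ bs)  = suc (countTrue bs)
countTrue (false ∷ bs) = countTrue bs

weight : ℕ → ℕ → ℤ
weight ℓ r = (+ ℓ ℤ.- + r) ℤ.+ + 1

rowsOf : ∀ {n L} → Vec (Subset n) L → List (List Bool)
rowsOf M = Vec.toList (Vec.map Vec.toList M)

ballsOf : ℕ → List (Maybe ℕ) → List (ℕ × ℕ)
ballsOf i []             = []
ballsOf i (nothing ∷ xs) = ballsOf (suc i) xs
ballsOf i (just ℓ ∷ xs)  = (i , ℓ) ∷ ballsOf (suc i) xs

-- one step: source row r with labels `src` (nothing = no ball), target row
-- r-1 with balls `tgt`.  Returns labels of row r-1 and the wrap weight.
fmStep : ℕ → ℕ → List (Maybe ℕ) → List Bool → List (Maybe ℕ) × ℤ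
fmStep n r src tgt = finish (foldl pair (map (λ _ → nothing) tgt , + 0) (sortDesc (ballsOf 0 src)))
  where
  pair : List (Maybe ℕ) × ℤ → ℕ × ℕ → List (Maybe ℕ) × ℤ
  pair (lab , acc) (c , ℓ) with firstSuch (λ j → at false tgt j ∧ is-nothing (at nothing lab j)) (cycRight n c)
  ... | nothing = (lab , acc)
  ... | just j  = (setAt lab j (just ℓ) , (if j <ᵇ c then acc ℤ.+ weight ℓ r else acc))
  fill : List Bool → List (Maybe ℕ) → List (Maybe ℕ)
  fill (true ∷ bs) (nothing ∷ ls) = just (r ∸ 1) ∷ fill bs ls
  fill (_ ∷ bs)    (l ∷ ls)       = l ∷ fill bs ls
  fill _           _              = []
  finish : List (Maybe ℕ) × ℤ → List (Maybe ℕ) × ℤ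
  finish (lab , acc) = (fill tgt lab , acc)

-- r = current (source) row, labels of row r, rows r-1, r-2, …, 1
fmGo : ℕ → ℕ → List (Maybe ℕ) → List (List Bool) → ℤ
fmGo n r lab []         = + 0
fmGo n r lab (t ∷ rest) with fmStep n r lab t
... | (lab' , w) = w ℤ.+ fmGo n (r ∸ 1) lab' rest

maj : ∀ {n L} → Vec (Subset n) L → ℤ
maj {n} {L} M with reverse (rowsOf M)
... | []         = + 0
... | top ∷ rest = fmGo n L (map (λ b → if b then just L else nothing) top) rest

-- one step: source row rs = r+1 with labels w (every site labelled),
-- target row r with particles `tgt`.  Returns labels of row r and
-- Σ (m - a)-weighted contributions of this step.
genStep : ℕ → ℕ → List ℕ → List Bool → List ℕ × ℤ
genStep n rs w tgt =
  finish (foldl antiPair (foldl partPair (map (λ _ → nothing) tgt , + 0) (take s order))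
                         (reverse (drop s order)))
  where
  s : ℕ
  s = countTrue tgt
  order : List (ℕ × ℕ)
  order = sortDesc (zip (upTo n) w)
  partPair : List (Maybe ℕ) × ℤ → ℕ × ℕ → List (Maybe ℕ) × ℤ
  partPair (lab , acc) (c , ℓ) with firstSuch (λ j → at false tgt j ∧ is-nothing (at nothing lab j)) (cycRight n c)
  ... | nothing = (lab , acc)
  ... | just j  = (setAt lab j (just ℓ) , (if j <ᵇ c then acc ℤ.+ weight ℓ rs else acc))
  antiPair : List (Maybe ℕ) × ℤ → ℕ × ℕ → List (Maybe ℕ) × ℤ
  antiPair (lab , acc) (c , ℓ) with firstSuch (λ j → not (at true tgt j) ∧ is-nothing (at nothing lab j)) (cycLeft n c)
  ... | nothing = (lab , acc)
  ... | just j  = (setAt lab j (just (ℓ ∸ 1)) , (if c <ᵇ j then acc ℤ.- weight ℓ rs else acc))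
  finish : List (Maybe ℕ) × ℤ → List ℕ × ℤ
  finish (lab , acc) = (map (fromMaybe 0) lab , acc)

genGo : ℕ → ℕ → List ℕ → List (List Bool) → ℤ
genGo n rs w []         = + 0
genGo n rs w (t ∷ rest) with genStep n rs w t
... | (w' , c) = c ℤ.+ genGo n (rs ∸ 1) w' rest

majG : ∀ {n L} → Vec (Subset n) L → ℤ
majG {n} {L} B with reverse (rowsOf B)
... | []         = + 0
... | top ∷ rest = genGo n L (map (λ b → if b then L else L ∸ 1) top) rest

{-# OPTIONS --safe #-}
module Submission where

-- The row sizes of an MLQ weakly increase downwards, and by
-- induction the generalized label of a site of row r+1 is its Ferrari–Martin label (≥ r+1)
-- if it holds a ball and r if it is empty. Sorting by decreasing label therefore lists the
-- balls in exactly the Ferrari–Martin order, followed by the empty sites from left to right.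
-- The particle phase thus first makes the Ferrari–Martin pairings, after which label-r
-- sources put r on the balls of row r left unlabelled, as the Ferrari–Martin rule does; the
-- anti-particle phase puts r-1 on every empty site. A pairing from a label-r source at row
-- r+1 has weight r-(r+1)+1 = 0, so both labellings accumulate the same maj, and the
-- invariant descends to row r.

open import Defs
open import Data.Bool using (Bool; true; false; if_then_else_; not; _∧_)
open import Data.Fin using (toℕ)
import Data.Fin as Fin
open import Data.Fin.Subset using (Subset; ∣_∣)
open import Data.Integer as ℤ using (ℤ; +_)
import Data.Integer.Properties as ℤ
open import Data.List using (List; []; _∷_; _++_; [_]; length; map; foldl; take; drop; reverse; zip; upTo; applyUpTo; applyDownFrom)
open import Data.List.Membership.Propositional using (_∈_)
open import Data.List.Membership.Propositional.Properties using (∈-upTo⁺; ∈-++⁺ˡ; ∈-++⁺ʳ; ∈-map⁺)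
open import Data.List.Properties using (foldl-cong; foldl-++; length-map; length-take; length-drop; length-reverse; ++-assoc; ++-identityʳ; reverse-map; reverse-applyUpTo)
open import Data.List.Relation.Binary.Pointwise using (Pointwise; []; _∷_; Pointwise-length)
open import Data.List.Relation.Binary.Sublist.Propositional using (⊆-refl)
open import Data.List.Relation.Binary.Sublist.Propositional.Properties using (filter⁺; length-mono-≤)
open import Data.List.Relation.Unary.All as All using (All; []; _∷_)
import Data.List.Relation.Unary.All.Properties as All
open import Data.List.Relation.Unary.Any using (here; there)
import Data.List.Relation.Unary.Any.Properties as Any
open import Data.List.Relation.Unary.Linked using (Linked; _∷_)
import Data.List.Relation.Unary.Linked.Properties as Linked
open import Data.Maybe using (Maybe; just; nothing; is-nothing; fromMaybe)
open import Data.Nat using (ℕ; zero; suc; _+_; _∸_; _≤_; _<_; _<ᵇ_; _≤ᵇ_; z≤n; s≤s; _≤?_; _<?_)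
open import Data.Nat.Properties using (≤-refl; ≤-reflexive; ≤⇒pred≤; n<1+n; ≮⇒≥; ≰⇒>; <⇒≱; m≤m+n; +-suc; +-comm; +-assoc; +-identityʳ; +-cancelʳ-≡; suc-injective; m+n∸n≡m; m+n∸m≡n; m+[n∸m]≡n; ∸-monoˡ-<; m≤n⇒m⊓n≡m; ≤ᵇ-reflects-≤)
open import Data.Product using (_×_; _,_; proj₁; proj₂; Σ; ∃-syntax)
open import Data.Unit using (⊤; tt)
open import Data.Vec using (Vec)
import Data.Vec as Vec
open import Data.Vec.Properties using (length-toList)
open import Function using (_∘_; flip)
open import Relation.Binary.PropositionalEquality using (_≡_; refl; sym; trans; cong; cong₂; subst; subst₂; module ≡-Reasoning)
open import Relation.Nullary using (yes; no; contradiction)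
open import Relation.Nullary.Reflects using (ofʸ; ofⁿ)

take-++-prefix : ∀ {A : Set} (xs ys : List A) m → take (length xs + m) (xs ++ ys) ≡ xs ++ take m ys
take-++-prefix []       ys m = refl
take-++-prefix (x ∷ xs) ys m = cong (x ∷_) (take-++-prefix xs ys m)

drop-++-prefix : ∀ {A : Set} (xs ys : List A) m → drop (length xs + m) (xs ++ ys) ≡ drop m ys
drop-++-prefix []       ys m = refl
drop-++-prefix (x ∷ xs) ys m = drop-++-prefix xs ys m

All-reverse : ∀ {A : Set} {P : A → Set} {xs} → All P xs → All P (reverse xs)
All-reverse Pxs = All.tabulate (λ x∈ → All.lookup Pxs (Any.reverse⁻ x∈))

length-setAt : ∀ {A : Set} (xs : List A) j y → length (setAt xs j y) ≡ length xs
length-setAt []       j       y = refl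
length-setAt (x ∷ xs) zero    y = refl
length-setAt (x ∷ xs) (suc j) y = cong suc (length-setAt xs j y)

at-map-not : ∀ bs j → at false (map not bs) j ≡ not (at true bs j)
at-map-not []       j       = refl
at-map-not (b ∷ bs) zero    = refl
at-map-not (b ∷ bs) (suc j) = at-map-not bs j

at-default : ∀ bs j → at false bs j ≡ true → at true bs j ≡ true
at-default (b ∷ bs) zero    eq = eq
at-default (b ∷ bs) (suc j) eq = at-default bs j eq

∧-is-nothing⁺ : ∀ {b} {m : Maybe ℕ} → b ≡ true → m ≡ nothing → (b ∧ is-nothing m) ≡ true
∧-is-nothing⁺ refl refl = refl

∧-is-nothing⁻ : ∀ b (m : Maybe ℕ) → (b ∧ is-nothing m) ≡ true → b ≡ true × m ≡ nothing
∧-is-nothing⁻ true  nothing  _  = refl , refl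
∧-is-nothing⁻ true  (just _) ()
∧-is-nothing⁻ false _        ()

if-then-≡ : ∀ {A : Set} b {x y : A} → x ≡ y → (if b then x else y) ≡ y
if-then-≡ true  eq = eq
if-then-≡ false _  = refl

firstSuch-finds : ∀ (P : ℕ → Bool) {y ys} → y ∈ ys → P y ≡ true → ∃[ j ] firstSuch P ys ≡ just j × P j ≡ true
firstSuch-finds P {ys = x ∷ xs} y∈ Py with P x in Px
... | true = x , refl , Px
firstSuch-finds P (here refl) Py | false = contradiction (trans (sym Px) Py) λ ()
firstSuch-finds P (there y∈) Py | false = firstSuch-finds P y∈ Py

cycRight-complete : ∀ {n} c {j} → j < n → j ∈ cycRight n c
cycRight-complete {n} c {j} j<n with j <? c
... | yes j<c = ∈-++⁺ʳ _ (∈-upTo⁺ j<c)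
... | no j≮c  = ∈-++⁺ˡ (subst (_∈ map (λ k → c + k) (upTo (n ∸ c))) (m+[n∸m]≡n c≤j)
                               (∈-map⁺ (λ k → c + k) (∈-upTo⁺ (∸-monoˡ-< j<n c≤j))))
  where
  c≤j : c ≤ j
  c≤j = ≮⇒≥ j≮c

cycLeft-complete : ∀ {n} c {j} → j < n → j ∈ cycLeft n c
cycLeft-complete {n} c {j} j<n with j ≤? c
... | yes j≤c = ∈-++⁺ˡ (Any.reverse⁺ (∈-upTo⁺ (s≤s j≤c)))
... | no j≰c  = ∈-++⁺ʳ _ (Any.reverse⁺ (subst (_∈ map (λ k → suc c + k) (upTo (n ∸ suc c))) (m+[n∸m]≡n c<j)
                                              (∈-map⁺ (λ k → suc c + k) (∈-upTo⁺ (∸-monoˡ-< j<n c<j)))))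
  where
  c<j : c < j
  c<j = ≰⇒> j≰c

countTrue-not : ∀ bs → countTrue (map not bs) + countTrue bs ≡ length bs
countTrue-not []           = refl
countTrue-not (true ∷ bs)  = trans (+-suc _ _) (cong suc (countTrue-not bs))
countTrue-not (false ∷ bs) = cong suc (countTrue-not bs)

countTrue-toList : ∀ {m} (x : Subset m) → countTrue (Vec.toList x) ≡ ∣ x ∣
countTrue-toList Vec.[]          = refl
countTrue-toList (true Vec.∷ x)  = cong suc (countTrue-toList x)
countTrue-toList (false Vec.∷ x) = countTrue-toList x

weight-neutral : ∀ r → weight r (suc r) ≡ + 0
weight-neutral r = cong (ℤ._+ + 1) (begin
  + r ℤ.- + suc r    ≡⟨ ℤ.m-n≡m⊖n r (suc r) ⟩
  r ℤ.⊖ suc r        ≡⟨ ℤ.⊖-< (n<1+n r) ⟩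
  ℤ.- + (suc r ∸ r)  ≡⟨ cong (λ m → ℤ.- + m) (m+n∸n≡m 1 r) ⟩
  ℤ.- + 1            ∎)
  where open ≡-Reasoning

Labels : Set
Labels = List (Maybe ℕ)

State : Set
State = Labels × ℤ

Pairing : Set
Pairing = State → ℕ × ℕ → State

blank : List Bool → Labels
blank = map (λ _ → nothing)

completed : State → List ℕ × ℤ
completed (lab , acc) = (map (fromMaybe 0) lab , acc)

twoPhases : Pairing → Pairing → ℕ → List (ℕ × ℕ) → List Bool → State
twoPhases part anti s order tgt = foldl anti (foldl part (blank tgt , + 0) (take s order)) (reverse (drop s order))

genStepWith : Pairing → Pairing → ℕ → List ℕ → List Bool → List ℕ × ℤ
genStepWith part anti n w tgt = completed (twoPhases part anti (countTrue tgt) (sortDesc (zip (upTo n) w)) tgt)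

-- The pairings of genStep and fmStep are local to their where blocks; stating the unfolded
-- definitions with the pairings as metavariables lets unification name them.
genStep-pairings : ∀ n rs w tgt → Σ Pairing λ part → Σ Pairing λ anti → genStep n rs w tgt ≡ genStepWith part anti n w tgt
genStep-pairings n rs w tgt = _ , _ , refl

genParticlePair : ℕ → ℕ → List ℕ → List Bool → Pairing
genParticlePair n rs w tgt = proj₁ (genStep-pairings n rs w tgt)

genAntiPair : ℕ → ℕ → List ℕ → List Bool → Pairing
genAntiPair n rs w tgt = proj₁ (proj₂ (genStep-pairings n rs w tgt))

fmParticlePhase : Pairing → List Bool → Labels → State
fmParticlePhase pair tgt src = foldl pair (blank tgt , + 0) (sortDesc (ballsOf 0 src))

fmStep-pairing : ∀ n r src tgt → Σ Pairing λ pair → proj₂ (fmStep n r src tgt) ≡ proj₂ (fmParticlePhase pair tgt src)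
fmStep-pairing n r src tgt = _ , refl

fmPair : ℕ → ℕ → Labels → List Bool → Pairing
fmPair n r src tgt = proj₁ (fmStep-pairing n r src tgt)

headWith : (Labels → Labels) → Labels → Labels
headWith f []       = []
headWith f (l ∷ ls) = l ∷ f ls

-- Past a leading empty site, fmStep's local `fill` recurses with the target row (a
-- parameter of the where block) and the rest of the row as separate arguments; abstracting
-- both turns the constraint into a pattern that unification solves.
fmStep-fill : ∀ n r src → Σ (List Bool → List Bool → Labels → Labels) λ fill →
  ∀ bs → proj₁ (fmStep n r src (false ∷ bs)) ≡
         headWith (fill (false ∷ bs) bs) (proj₁ (fmParticlePhase (fmPair n r src (false ∷ bs)) (false ∷ bs) src))
fmStep-fill n r src = fill , unfolded
  where
  fill : List Bool → List Bool → Labels → Labels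
  fill = _
  unfolded : ∀ bs → proj₁ (fmStep n r src (false ∷ bs)) ≡
                    headWith (fill (false ∷ bs) bs) (proj₁ (fmParticlePhase (fmPair n r src (false ∷ bs)) (false ∷ bs) src))
  unfolded bs with proj₁ (fmParticlePhase (fmPair n r src (false ∷ bs)) (false ∷ bs) src)
  ... | []     = refl
  ... | _ ∷ _ with false ∷ bs
  ... | _ = refl

fmFill : ℕ → ℕ → Labels → List Bool → List Bool → Labels → Labels
fmFill n r src = proj₁ (fmStep-fill n r src)

pairRight : ℕ → ℕ → List Bool → Pairing
pairRight n r tgt (lab , acc) (c , ℓ) with firstSuch (λ j → at false tgt j ∧ is-nothing (at nothing lab j)) (cycRight n c)
... | nothing = (lab , acc)
... | just j  = (setAt lab j (just ℓ) , (if j <ᵇ c then acc ℤ.+ weight ℓ r else acc))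

genParticlePair≗pairRight : ∀ n rs w tgt st x → genParticlePair n rs w tgt st x ≡ pairRight n rs tgt st x
genParticlePair≗pairRight n rs w tgt (lab , acc) (c , ℓ) with firstSuch (λ j → at false tgt j ∧ is-nothing (at nothing lab j)) (cycRight n c)
... | nothing = refl
... | just j  = refl

fmPair≗pairRight : ∀ n r src tgt st x → fmPair n r src tgt st x ≡ pairRight n r tgt st x
fmPair≗pairRight n r src tgt (lab , acc) (c , ℓ) with firstSuch (λ j → at false tgt j ∧ is-nothing (at nothing lab j)) (cycRight n c)
... | nothing = refl
... | just j  = refl

IsFree : List Bool → Labels → ℕ → Set
IsFree mask lab j = at false mask j ≡ true × at nothing lab j ≡ nothing

freeSites : List Bool → Labels → ℕ
freeSites []           _              = 0
freeSites (_ ∷ _)      []             = 0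
freeSites (true ∷ bs)  (nothing ∷ ls) = suc (freeSites bs ls)
freeSites (true ∷ bs)  (just _ ∷ ls)  = freeSites bs ls
freeSites (false ∷ bs) (_ ∷ ls)       = freeSites bs ls

fillWith : List Bool → ℕ → Labels → Labels
fillWith []           v ls             = ls
fillWith (_ ∷ _)      v []             = []
fillWith (true ∷ bs)  v (nothing ∷ ls) = just v ∷ fillWith bs v ls
fillWith (true ∷ bs)  v (just x ∷ ls)  = just x ∷ fillWith bs v ls
fillWith (false ∷ bs) v (l ∷ ls)       = l ∷ fillWith bs v ls

length-fillWith : ∀ mask v lab → length (fillWith mask v lab) ≡ length lab
length-fillWith []           v lab            = refl
length-fillWith (_ ∷ _)      v []             = refl
length-fillWith (true ∷ bs)  v (nothing ∷ ls) = cong suc (length-fillWith bs v ls)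
length-fillWith (true ∷ bs)  v (just x ∷ ls)  = cong suc (length-fillWith bs v ls)
length-fillWith (false ∷ bs) v (l ∷ ls)       = cong suc (length-fillWith bs v ls)

freeSite : ∀ mask lab {k} → freeSites mask lab ≡ suc k → ∃[ j ] j < length mask × IsFree mask lab j
freeSite (true ∷ bs)  (nothing ∷ ls) _  = zero , s≤s z≤n , refl , refl
freeSite (true ∷ bs)  (just _ ∷ ls)  eq with j , j< , free ← freeSite bs ls eq = suc j , s≤s j< , free
freeSite (false ∷ bs) (_ ∷ ls)       eq with j , j< , free ← freeSite bs ls eq = suc j , s≤s j< , free

freeSites-setAt-free : ∀ mask lab j v → IsFree mask lab j → length lab ≡ length mask →
  freeSites mask lab ≡ suc (freeSites mask (setAt lab j (just v)))
freeSites-setAt-free (true ∷ bs)  (nothing ∷ ls) zero    v _    _   = refl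
freeSites-setAt-free (true ∷ bs)  (nothing ∷ ls) (suc j) v free len = cong suc (freeSites-setAt-free bs ls j v free (suc-injective len))
freeSites-setAt-free (true ∷ bs)  (just x ∷ ls)  (suc j) v free len = freeSites-setAt-free bs ls j v free (suc-injective len)
freeSites-setAt-free (false ∷ bs) (l ∷ ls)       (suc j) v free len = freeSites-setAt-free bs ls j v free (suc-injective len)
freeSites-setAt-free [] _ _ _ (() , _) _
freeSites-setAt-free (_ ∷ _) [] _ _ _ ()
freeSites-setAt-free (true ∷ bs)  (just x ∷ ls) zero _ (_ , ()) _
freeSites-setAt-free (false ∷ bs) (l ∷ ls)      zero _ (() , _) _

freeSites-setAt-occupied : ∀ mask lab j v → at false mask j ≡ false → freeSites mask (setAt lab j (just v)) ≡ freeSites mask lab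
freeSites-setAt-occupied []           lab            j       v _  = refl
freeSites-setAt-occupied (_ ∷ _)      []             j       v _  = refl
freeSites-setAt-occupied (false ∷ bs) (l ∷ ls)       zero    v _  = refl
freeSites-setAt-occupied (true ∷ bs)  (nothing ∷ ls) (suc j) v eq = cong suc (freeSites-setAt-occupied bs ls j v eq)
freeSites-setAt-occupied (true ∷ bs)  (just x ∷ ls)  (suc j) v eq = freeSites-setAt-occupied bs ls j v eq
freeSites-setAt-occupied (false ∷ bs) (l ∷ ls)       (suc j) v eq = freeSites-setAt-occupied bs ls j v eq

fillWith-setAt : ∀ mask v lab j → IsFree mask lab j → fillWith mask v (setAt lab j (just v)) ≡ fillWith mask v lab
fillWith-setAt (b ∷ bs)     v []             j       _    = refl
fillWith-setAt (true ∷ bs)  v (nothing ∷ ls) zero    _    = refl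
fillWith-setAt (true ∷ bs)  v (nothing ∷ ls) (suc j) free = cong (just v ∷_) (fillWith-setAt bs v ls j free)
fillWith-setAt (true ∷ bs)  v (just x ∷ ls)  (suc j) free = cong (just x ∷_) (fillWith-setAt bs v ls j free)
fillWith-setAt (false ∷ bs) v (l ∷ ls)       (suc j) free = cong (l ∷_) (fillWith-setAt bs v ls j free)
fillWith-setAt []           v lab            j       (() , _)
fillWith-setAt (true ∷ bs)  v (just x ∷ ls)  zero    (_ , ())
fillWith-setAt (false ∷ bs) v (l ∷ ls)       zero    (() , _)

fillWith-full : ∀ mask v lab → freeSites mask lab ≡ 0 → fillWith mask v lab ≡ lab
fillWith-full []           v lab            _  = refl
fillWith-full (_ ∷ _)      v []             _  = refl
fillWith-full (true ∷ bs)  v (just x ∷ ls)  eq = cong (just x ∷_) (fillWith-full bs v ls eq)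
fillWith-full (false ∷ bs) v (l ∷ ls)       eq = cong (l ∷_) (fillWith-full bs v ls eq)
fillWith-full (true ∷ bs)  v (nothing ∷ ls) ()

freeSites-complement-fillWith : ∀ mask v lab → freeSites (map not mask) (fillWith mask v lab) ≡ freeSites (map not mask) lab
freeSites-complement-fillWith []           v lab            = refl
freeSites-complement-fillWith (_ ∷ _)      v []             = refl
freeSites-complement-fillWith (true ∷ bs)  v (nothing ∷ ls) = freeSites-complement-fillWith bs v ls
freeSites-complement-fillWith (true ∷ bs)  v (just x ∷ ls)  = freeSites-complement-fillWith bs v ls
freeSites-complement-fillWith (false ∷ bs) v (nothing ∷ ls) = cong suc (freeSites-complement-fillWith bs v ls)
freeSites-complement-fillWith (false ∷ bs) v (just x ∷ ls)  = freeSites-complement-fillWith bs v ls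

freeSites-blank : ∀ mask (bs : List Bool) → length mask ≡ length bs → freeSites mask (blank bs) ≡ countTrue mask
freeSites-blank []           []       _   = refl
freeSites-blank (true ∷ ms)  (_ ∷ bs) len = cong suc (freeSites-blank ms bs (suc-injective len))
freeSites-blank (false ∷ ms) (_ ∷ bs) len = freeSites-blank ms bs (suc-injective len)

pairRight-found : ∀ n r tgt lab acc c ℓ {j} →
  firstSuch (λ j → at false tgt j ∧ is-nothing (at nothing lab j)) (cycRight n c) ≡ just j →
  pairRight n r tgt (lab , acc) (c , ℓ) ≡ (setAt lab j (just ℓ) , (if j <ᵇ c then acc ℤ.+ weight ℓ r else acc))
pairRight-found n r tgt lab acc c ℓ found rewrite found = refl

genAntiPair-found : ∀ n rs w tgt lab acc c ℓ {j} →
  firstSuch (λ j → not (at true tgt j) ∧ is-nothing (at nothing lab j)) (cycLeft n c) ≡ just j →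
  genAntiPair n rs w tgt (lab , acc) (c , ℓ) ≡ (setAt lab j (just (ℓ ∸ 1)) , (if c <ᵇ j then acc ℤ.- weight ℓ rs else acc))
genAntiPair-found n rs w tgt lab acc c ℓ found rewrite found = refl

pairRight-fills : ∀ {n} r tgt lab {k} → length tgt ≡ n → freeSites tgt lab ≡ suc k → ∀ acc c ℓ →
  ∃[ j ] IsFree tgt lab j × pairRight n r tgt (lab , acc) (c , ℓ) ≡ (setAt lab j (just ℓ) , (if j <ᵇ c then acc ℤ.+ weight ℓ r else acc))
pairRight-fills r tgt lab refl free≡ acc c ℓ
  with j₀ , j₀<n , mask-j₀ , lab-j₀ ← freeSite tgt lab free≡
  with j , found , Pj ← firstSuch-finds (λ j → at false tgt j ∧ is-nothing (at nothing lab j)) (cycRight-complete c j₀<n) (∧-is-nothing⁺ mask-j₀ lab-j₀)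
  = j , ∧-is-nothing⁻ _ _ Pj , pairRight-found (length tgt) r tgt lab acc c ℓ found

genAntiPair-fills : ∀ {n} rs w tgt lab {k} → length tgt ≡ n → freeSites (map not tgt) lab ≡ suc k → ∀ acc c ℓ →
  ∃[ j ] IsFree (map not tgt) lab j × genAntiPair n rs w tgt (lab , acc) (c , ℓ) ≡ (setAt lab j (just (ℓ ∸ 1)) , (if c <ᵇ j then acc ℤ.- weight ℓ rs else acc))
genAntiPair-fills rs w tgt lab refl free≡ acc c ℓ
  with j₀ , j₀<n , mask-j₀ , lab-j₀ ← freeSite (map not tgt) lab free≡
  with j , found , Pj ← firstSuch-finds (λ j → not (at true tgt j) ∧ is-nothing (at nothing lab j))
                          (cycLeft-complete {length tgt} c (subst (j₀ <_) (length-map not tgt) j₀<n))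
                          (∧-is-nothing⁺ (trans (sym (at-map-not tgt j₀)) mask-j₀) lab-j₀)
  with not-tgt-j , lab-j ← ∧-is-nothing⁻ _ _ Pj
  = j , (trans (at-map-not tgt j) not-tgt-j , lab-j) , genAntiPair-found (length tgt) rs w tgt lab acc c ℓ found

FillsFreeSites : List Bool → ℕ → ℕ → Pairing → Set
FillsFreeSites mask ℓ v pair = ∀ lab {k} acc c → length lab ≡ length mask → freeSites mask lab ≡ suc k →
  ∃[ j ] IsFree mask lab j × pair (lab , acc) (c , ℓ) ≡ (setAt lab j (just v) , acc)

foldl-fillsFreeSites : ∀ {mask ℓ v pair} → FillsFreeSites mask ℓ v pair → ∀ xs lab acc →
  All (λ q → proj₂ q ≡ ℓ) xs → length lab ≡ length mask → length xs ≡ freeSites mask lab →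
  foldl pair (lab , acc) xs ≡ (fillWith mask v lab , acc)
foldl-fillsFreeSites {mask} {ℓ} {v} {pair} fills [] lab acc [] _ len-xs =
  cong (_, acc) (sym (fillWith-full mask v lab (sym len-xs)))
foldl-fillsFreeSites {mask} {ℓ} {v} {pair} fills ((c , _) ∷ xs) lab acc (refl ∷ labelled) len-lab len-xs
  with j , free-j , step ← fills lab acc c len-lab (sym len-xs) = begin
    foldl pair (pair (lab , acc) (c , ℓ)) xs     ≡⟨ cong (λ st → foldl pair st xs) step ⟩
    foldl pair (setAt lab j (just v) , acc) xs  ≡⟨ foldl-fillsFreeSites fills xs _ acc labelled len-lab′ len-xs′ ⟩
    (fillWith mask v (setAt lab j (just v)) , acc) ≡⟨ cong (_, acc) (fillWith-setAt mask v lab j free-j) ⟩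
    (fillWith mask v lab , acc)                   ∎
  where
  open ≡-Reasoning
  len-lab′ : length (setAt lab j (just v)) ≡ length mask
  len-lab′ = trans (length-setAt lab j (just v)) len-lab
  len-xs′ : length xs ≡ freeSites mask (setAt lab j (just v))
  len-xs′ = suc-injective (trans len-xs (freeSites-setAt-free mask lab j v free-j len-lab))

pairRight-fillsNeutral : ∀ {n} r tgt → length tgt ≡ n → FillsFreeSites tgt r r (pairRight n (suc r) tgt)
pairRight-fillsNeutral r tgt len lab acc c len-lab free≡
  with j , free-j , step ← pairRight-fills (suc r) tgt lab len free≡ acc c r =
  j , free-j , trans step (cong (_ ,_) (if-then-≡ (j <ᵇ c) (trans (cong (λ x → acc ℤ.+ x) (weight-neutral r)) (ℤ.+-identityʳ acc))))

genAntiPair-fillsNeutral : ∀ {n} r w tgt → length tgt ≡ n → FillsFreeSites (map not tgt) r (r ∸ 1) (genAntiPair n (suc r) w tgt)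
genAntiPair-fillsNeutral r w tgt len lab acc c len-lab free≡
  with j , free-j , step ← genAntiPair-fills (suc r) w tgt lab len free≡ acc c r =
  j , free-j , trans step (cong (_ ,_) (if-then-≡ (c <ᵇ j) (trans (cong (λ x → acc ℤ.- x) (weight-neutral r)) (ℤ.+-identityʳ acc))))

BallLabel : ℕ → Maybe ℕ → Bool → Set
BallLabel r nothing  b = ⊤
BallLabel r (just ℓ) b = b ≡ true × r ≤ ℓ

LabelsOnBalls : ℕ → Labels → List Bool → Set
LabelsOnBalls r = Pointwise (BallLabel r)

LabelsOnBalls-blank : ∀ r tgt → LabelsOnBalls r (blank tgt) tgt
LabelsOnBalls-blank r []       = []
LabelsOnBalls-blank r (_ ∷ bs) = tt ∷ LabelsOnBalls-blank r bs

LabelsOnBalls-setAt : ∀ {r lab tgt} j {ℓ} → LabelsOnBalls r lab tgt → at false tgt j ≡ true → r ≤ ℓ →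
  LabelsOnBalls r (setAt lab j (just ℓ)) tgt
LabelsOnBalls-setAt zero    (_ ∷ labels)  ball r≤ℓ = (ball , r≤ℓ) ∷ labels
LabelsOnBalls-setAt (suc j) (ok ∷ labels) ball r≤ℓ = ok ∷ LabelsOnBalls-setAt j labels ball r≤ℓ

ExtendsOnBalls : ℕ → List Bool → ℕ → Labels → Labels → Set
ExtendsOnBalls r tgt e lab lab′ =
  LabelsOnBalls r lab′ tgt × freeSites tgt lab′ ≡ e × freeSites (map not tgt) lab′ ≡ freeSites (map not tgt) lab

foldl-pairRight-extendsOnBalls : ∀ {n r tgt} → length tgt ≡ n → ∀ xs lab acc {e} →
  All (λ q → r ≤ proj₂ q) xs → LabelsOnBalls r lab tgt → length xs + e ≡ freeSites tgt lab →
  ExtendsOnBalls r tgt e lab (proj₁ (foldl (pairRight n r tgt) (lab , acc) xs))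
foldl-pairRight-extendsOnBalls len [] lab acc [] labels count = labels , sym count , refl
foldl-pairRight-extendsOnBalls {n} {r} {tgt} len ((c , ℓ) ∷ xs) lab acc (r≤ℓ ∷ above) labels count
  with j , (ball , lab-j) , step ← pairRight-fills r tgt lab len (sym count) acc c ℓ
  rewrite step
  with labels′ , count′ , complement′ ← foldl-pairRight-extendsOnBalls len xs (setAt lab j (just ℓ)) _ above
         (LabelsOnBalls-setAt j labels ball r≤ℓ)
         (suc-injective (trans count (freeSites-setAt-free tgt lab j ℓ (ball , lab-j) (Pointwise-length labels))))
  = labels′ , count′ , trans complement′ (freeSites-setAt-occupied (map not tgt) lab j ℓ
                                           (trans (at-map-not tgt j) (cong not (at-default tgt j ball))))

-- The invariant relating the Ferrari–Martin labels of a row r (nothing on an empty site) to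
-- its generalized labels.
Agree : ℕ → Maybe ℕ → ℕ → Set
Agree r (just ℓ) x = x ≡ ℓ × r ≤ ℓ
Agree r nothing  x = x ≡ r ∸ 1

Agreeing : ℕ → Labels → List ℕ → Set
Agreeing r = Pointwise (Agree r)

countJust : Labels → ℕ
countJust []             = 0
countJust (just _ ∷ ls)  = suc (countJust ls)
countJust (nothing ∷ ls) = countJust ls

vacantSites : ℕ → ℕ → Labels → List (ℕ × ℕ)
vacantSites v i []             = []
vacantSites v i (nothing ∷ ls) = (i , v) ∷ vacantSites v (suc i) ls
vacantSites v i (just _ ∷ ls)  = vacantSites v (suc i) ls

indexedFrom : ℕ → List ℕ → List (ℕ × ℕ)
indexedFrom i []       = []
indexedFrom i (x ∷ xs) = (i , x) ∷ indexedFrom (suc i) xs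

length-ballsOf : ∀ i src → length (ballsOf i src) ≡ countJust src
length-ballsOf i []              = refl
length-ballsOf i (just _ ∷ src)  = cong suc (length-ballsOf (suc i) src)
length-ballsOf i (nothing ∷ src) = length-ballsOf (suc i) src

length-vacantSites : ∀ v i src → length (vacantSites v i src) + countJust src ≡ length src
length-vacantSites v i []              = refl
length-vacantSites v i (nothing ∷ src) = cong suc (length-vacantSites v (suc i) src)
length-vacantSites v i (just _ ∷ src)  = trans (+-suc _ _) (cong suc (length-vacantSites v (suc i) src))

vacantSites-labels : ∀ v i src → All (λ q → proj₂ q ≡ v) (vacantSites v i src)
vacantSites-labels v i []              = []
vacantSites-labels v i (nothing ∷ src) = refl ∷ vacantSites-labels v (suc i) src
vacantSites-labels v i (just _ ∷ src)  = vacantSites-labels v (suc i) src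

ballsOf-labels : ∀ {r src w} i → Agreeing r src w → All (λ q → r ≤ proj₂ q) (ballsOf i src)
ballsOf-labels i []                                      = []
ballsOf-labels {src = just _ ∷ _}  i ((_ , r≤ℓ) ∷ agree) = r≤ℓ ∷ ballsOf-labels (suc i) agree
ballsOf-labels {src = nothing ∷ _} i (_ ∷ agree)         = ballsOf-labels (suc i) agree

insDesc-++-below : ∀ p xs ys → All (λ q → proj₂ q < proj₂ p) ys → insDesc p (xs ++ ys) ≡ insDesc p xs ++ ys
insDesc-++-below p         []               []               _           = refl
insDesc-++-below (pc , pl) []               ((qc , ql) ∷ ys) (ql<pl ∷ _) with pl ≤ᵇ ql | ≤ᵇ-reflects-≤ pl ql
... | true  | ofʸ pl≤ql = contradiction pl≤ql (<⇒≱ ql<pl)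
... | false | _         = refl
insDesc-++-below (pc , pl) ((qc , ql) ∷ xs) ys               below       with pl ≤ᵇ ql
... | true  = cong ((qc , ql) ∷_) (insDesc-++-below (pc , pl) xs ys below)
... | false = refl

insDesc-last : ∀ p xs → All (λ q → proj₂ p ≤ proj₂ q) xs → insDesc p xs ≡ xs ++ [ p ]
insDesc-last p         []               _              = refl
insDesc-last (pc , pl) ((qc , ql) ∷ xs) (pl≤ql ∷ above) with pl ≤ᵇ ql | ≤ᵇ-reflects-≤ pl ql
... | true  | _         = cong ((qc , ql) ∷_) (insDesc-last (pc , pl) xs above)
... | false | ofⁿ pl≰ql = contradiction pl≤ql pl≰ql

insDesc-All : ∀ {Q : ℕ × ℕ → Set} p xs → Q p → All Q xs → All Q (insDesc p xs)
insDesc-All p         []               Qp []         = Qp ∷ []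
insDesc-All (pc , pl) ((qc , ql) ∷ xs) Qp (Qq ∷ Qxs) with pl ≤ᵇ ql
... | true  = Qq ∷ insDesc-All (pc , pl) xs Qp Qxs
... | false = Qp ∷ Qq ∷ Qxs

length-insDesc : ∀ p xs → length (insDesc p xs) ≡ suc (length xs)
length-insDesc p         []               = refl
length-insDesc (pc , pl) ((qc , ql) ∷ xs) with pl ≤ᵇ ql
... | true  = cong suc (length-insDesc (pc , pl) xs)
... | false = refl

foldl-insDesc-All : ∀ {Q : ℕ × ℕ → Set} acc xs → All Q acc → All Q xs → All Q (foldl (flip insDesc) acc xs)
foldl-insDesc-All acc []       Qacc []         = Qacc
foldl-insDesc-All acc (x ∷ xs) Qacc (Qx ∷ Qxs) = foldl-insDesc-All (insDesc x acc) xs (insDesc-All x acc Qx Qacc) Qxs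

length-sortDesc : ∀ xs → length (sortDesc xs) ≡ length xs
length-sortDesc = go []
  where
  go : ∀ acc xs → length (foldl (flip insDesc) acc xs) ≡ length acc + length xs
  go acc []       = sym (+-identityʳ _)
  go acc (x ∷ xs) = trans (go (insDesc x acc) xs)
                          (trans (cong (_+ length xs) (length-insDesc x acc)) (sym (+-suc (length acc) (length xs))))

zip-applyUpTo : ∀ (f : ℕ → ℕ) i w → (∀ k → f k ≡ i + k) → zip (applyUpTo f (length w)) w ≡ indexedFrom i w
zip-applyUpTo f i []       _     = refl
zip-applyUpTo f i (x ∷ xs) f≗i+ =
  cong₂ _∷_ (cong (_, x) (trans (f≗i+ 0) (+-identityʳ i)))
            (zip-applyUpTo (f ∘ suc) (suc i) xs (λ k → trans (f≗i+ (suc k)) (+-suc i k)))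

-- insDesc is stable, so the empty sites, all of label r, keep their left-to-right order
-- behind the balls.
foldl-insDesc-split : ∀ {r src w} i xs ys → Agreeing (suc r) src w →
  All (λ q → suc r ≤ proj₂ q) xs → All (λ q → proj₂ q ≡ r) ys →
  foldl (flip insDesc) (xs ++ ys) (indexedFrom i w) ≡ foldl (flip insDesc) xs (ballsOf i src) ++ ys ++ vacantSites r i src
foldl-insDesc-split i xs ys [] _ _ = cong (xs ++_) (sym (++-identityʳ ys))
foldl-insDesc-split {r} {just ℓ ∷ src} {_ ∷ w} i xs ys ((refl , r<ℓ) ∷ agree) balls vacant =
  trans (cong (λ zs → foldl (flip insDesc) zs (indexedFrom (suc i) w))
              (insDesc-++-below (i , ℓ) xs ys (All.map (λ { refl → r<ℓ }) vacant)))
        (foldl-insDesc-split (suc i) (insDesc (i , ℓ) xs) ys agree (insDesc-All (i , ℓ) xs r<ℓ balls) vacant)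
foldl-insDesc-split {r} {nothing ∷ src} {_ ∷ w} i xs ys (refl ∷ agree) balls vacant = begin
  foldl (flip insDesc) (insDesc (i , r) (xs ++ ys)) (indexedFrom (suc i) w)
    ≡⟨ cong (λ zs → foldl (flip insDesc) zs (indexedFrom (suc i) w)) (insDesc-last (i , r) (xs ++ ys) above) ⟩
  foldl (flip insDesc) ((xs ++ ys) ++ [ (i , r) ]) (indexedFrom (suc i) w)
    ≡⟨ cong (λ zs → foldl (flip insDesc) zs (indexedFrom (suc i) w)) (++-assoc xs ys [ (i , r) ]) ⟩
  foldl (flip insDesc) (xs ++ ys ++ [ (i , r) ]) (indexedFrom (suc i) w)
    ≡⟨ foldl-insDesc-split (suc i) xs (ys ++ [ (i , r) ]) agree balls (All.++⁺ vacant (refl ∷ [])) ⟩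
  foldl (flip insDesc) xs (ballsOf (suc i) src) ++ (ys ++ [ (i , r) ]) ++ vacantSites r (suc i) src
    ≡⟨ cong (foldl (flip insDesc) xs (ballsOf (suc i) src) ++_) (++-assoc ys [ (i , r) ] (vacantSites r (suc i) src)) ⟩
  foldl (flip insDesc) xs (ballsOf (suc i) src) ++ ys ++ (i , r) ∷ vacantSites r (suc i) src ∎
  where
  open ≡-Reasoning
  above : All (λ q → r ≤ proj₂ q) (xs ++ ys)
  above = All.++⁺ (All.map ≤⇒pred≤ balls) (All.map (λ { refl → ≤-refl }) vacant)

sortDesc-sites : ∀ {n r src w} → Agreeing (suc r) src w → length w ≡ n →
  sortDesc (zip (upTo n) w) ≡ sortDesc (ballsOf 0 src) ++ vacantSites r 0 src
sortDesc-sites {w = w} agree refl =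
  trans (cong sortDesc (zip-applyUpTo (λ k → k) 0 w (λ _ → refl))) (foldl-insDesc-split 0 [] [] agree [] [])

module _ (n r : ℕ) (src : Labels) (T : List Bool) where

  fmFill-agrees : ∀ {lab tgt} → LabelsOnBalls (suc r) lab tgt →
    Agreeing r (fmFill n (suc r) src T tgt lab) (map (fromMaybe 0) (fillWith (map not tgt) (r ∸ 1) (fillWith tgt r lab)))
  fmFill-agrees [] = []
  fmFill-agrees {nothing ∷ _} {true ∷ _}  (_ ∷ labels)         = (refl , ≤-refl) ∷ fmFill-agrees labels
  fmFill-agrees {nothing ∷ _} {false ∷ _} (_ ∷ labels)         = refl ∷ fmFill-agrees labels
  fmFill-agrees {just _ ∷ _}  {true ∷ _}  ((_ , r<ℓ) ∷ labels) = (refl , ≤⇒pred≤ r<ℓ) ∷ fmFill-agrees labels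

  countJust-fmFill : ∀ {lab tgt} → LabelsOnBalls (suc r) lab tgt → countJust (fmFill n (suc r) src T tgt lab) ≡ countTrue tgt
  countJust-fmFill [] = refl
  countJust-fmFill {nothing ∷ _} {true ∷ _}  (_ ∷ labels) = cong suc (countJust-fmFill labels)
  countJust-fmFill {nothing ∷ _} {false ∷ _} (_ ∷ labels) = countJust-fmFill labels
  countJust-fmFill {just _ ∷ _}  {true ∷ _}  (_ ∷ labels) = cong suc (countJust-fmFill labels)

module OneRow (n r : ℕ) (src : Labels) (w : List ℕ) (tgt : List Bool)
              (agree : Agreeing (suc r) src w) (w-length : length w ≡ n) (tgt-length : length tgt ≡ n)
              (fits : countJust src ≤ countTrue tgt) where

  open ≡-Reasoning

  balls : List (ℕ × ℕ)
  balls = sortDesc (ballsOf 0 src)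

  vacant : List (ℕ × ℕ)
  vacant = vacantSites r 0 src

  spare : ℕ
  spare = countTrue tgt ∸ countJust src

  empty : ℕ
  empty = countTrue (map not tgt)

  phase₁ : State
  phase₁ = foldl (pairRight n (suc r) tgt) (blank tgt , + 0) balls

  lab₁ : Labels
  lab₁ = proj₁ phase₁

  acc₁ : ℤ
  acc₁ = proj₂ phase₁

  balls+spare : length balls + spare ≡ countTrue tgt
  balls+spare = trans (cong (_+ spare) (trans (length-sortDesc (ballsOf 0 src)) (length-ballsOf 0 src))) (m+[n∸m]≡n fits)

  phase₁-extends : ExtendsOnBalls (suc r) tgt spare (blank tgt) lab₁
  phase₁-extends = foldl-pairRight-extendsOnBalls tgt-length balls (blank tgt) (+ 0)
    (foldl-insDesc-All [] (ballsOf 0 src) [] (ballsOf-labels 0 agree))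
    (LabelsOnBalls-blank (suc r) tgt)
    (trans balls+spare (sym (freeSites-blank tgt tgt refl)))

  lab₁-onBalls : LabelsOnBalls (suc r) lab₁ tgt
  lab₁-onBalls = proj₁ phase₁-extends

  length-lab₁ : length lab₁ ≡ length tgt
  length-lab₁ = Pointwise-length lab₁-onBalls

  length-vacant : length vacant ≡ spare + empty
  length-vacant = +-cancelʳ-≡ (countJust src) _ _ (begin
    length vacant + countJust src     ≡⟨ length-vacantSites r 0 src ⟩
    length src                        ≡⟨ Pointwise-length agree ⟩
    length w                          ≡⟨ trans w-length (sym tgt-length) ⟩
    length tgt                        ≡⟨ sym (countTrue-not tgt) ⟩
    empty + countTrue tgt             ≡⟨ cong (λ m → empty + m) (sym (m+[n∸m]≡n fits)) ⟩
    empty + (countJust src + spare)   ≡⟨ cong (λ m → empty + m) (+-comm (countJust src) spare) ⟩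
    empty + (spare + countJust src)   ≡⟨ sym (+-assoc empty spare (countJust src)) ⟩
    empty + spare + countJust src     ≡⟨ cong (_+ countJust src) (+-comm empty spare) ⟩
    spare + empty + countJust src     ∎)

  particle-phase : foldl (genParticlePair n (suc r) w tgt) (blank tgt , + 0) (take (countTrue tgt) (balls ++ vacant))
                   ≡ (fillWith tgt r lab₁ , acc₁)
  particle-phase = begin
    foldl part (blank tgt , + 0) (take (countTrue tgt) (balls ++ vacant))
      ≡⟨ cong (λ m → foldl part (blank tgt , + 0) (take m (balls ++ vacant))) (sym balls+spare) ⟩
    foldl part (blank tgt , + 0) (take (length balls + spare) (balls ++ vacant))
      ≡⟨ cong (foldl part (blank tgt , + 0)) (take-++-prefix balls vacant spare) ⟩
    foldl part (blank tgt , + 0) (balls ++ take spare vacant)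
      ≡⟨ foldl-cong (genParticlePair≗pairRight n (suc r) w tgt) (blank tgt , + 0) (balls ++ take spare vacant) ⟩
    foldl (pairRight n (suc r) tgt) (blank tgt , + 0) (balls ++ take spare vacant)
      ≡⟨ foldl-++ (pairRight n (suc r) tgt) (blank tgt , + 0) balls (take spare vacant) ⟩
    foldl (pairRight n (suc r) tgt) phase₁ (take spare vacant)
      ≡⟨ foldl-fillsFreeSites {mask = tgt} (pairRight-fillsNeutral r tgt tgt-length) (take spare vacant) lab₁ acc₁
           (All.take⁺ spare (vacantSites-labels r 0 src)) length-lab₁ spare-length ⟩
    (fillWith tgt r lab₁ , acc₁) ∎
    where
    part : Pairing
    part = genParticlePair n (suc r) w tgt
    spare-length : length (take spare vacant) ≡ freeSites tgt lab₁
    spare-length = trans (length-take spare vacant)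
                         (trans (m≤n⇒m⊓n≡m (subst (spare ≤_) (sym length-vacant) (m≤m+n spare empty)))
                                (sym (proj₁ (proj₂ phase₁-extends))))

  anti-phase : foldl (genAntiPair n (suc r) w tgt) (fillWith tgt r lab₁ , acc₁) (reverse (drop (countTrue tgt) (balls ++ vacant)))
               ≡ (fillWith (map not tgt) (r ∸ 1) (fillWith tgt r lab₁) , acc₁)
  anti-phase = begin
    foldl anti (fillWith tgt r lab₁ , acc₁) (reverse (drop (countTrue tgt) (balls ++ vacant)))
      ≡⟨ cong (λ m → foldl anti (fillWith tgt r lab₁ , acc₁) (reverse (drop m (balls ++ vacant)))) (sym balls+spare) ⟩
    foldl anti (fillWith tgt r lab₁ , acc₁) (reverse (drop (length balls + spare) (balls ++ vacant)))
      ≡⟨ cong (λ xs → foldl anti (fillWith tgt r lab₁ , acc₁) (reverse xs)) (drop-++-prefix balls vacant spare) ⟩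
    foldl anti (fillWith tgt r lab₁ , acc₁) (reverse (drop spare vacant))
      ≡⟨ foldl-fillsFreeSites {mask = map not tgt} (genAntiPair-fillsNeutral r w tgt tgt-length) (reverse (drop spare vacant)) _ acc₁
           (All-reverse (All.drop⁺ spare (vacantSites-labels r 0 src)))
           (trans (length-fillWith tgt r lab₁) (trans length-lab₁ (sym (length-map not tgt))))
           empty-length ⟩
    (fillWith (map not tgt) (r ∸ 1) (fillWith tgt r lab₁) , acc₁) ∎
    where
    anti : Pairing
    anti = genAntiPair n (suc r) w tgt
    empty-length : length (reverse (drop spare vacant)) ≡ freeSites (map not tgt) (fillWith tgt r lab₁)
    empty-length = begin
      length (reverse (drop spare vacant))           ≡⟨ length-reverse (drop spare vacant) ⟩
      length (drop spare vacant)                     ≡⟨ length-drop spare vacant ⟩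
      length vacant ∸ spare                          ≡⟨ cong (_∸ spare) length-vacant ⟩
      spare + empty ∸ spare                          ≡⟨ m+n∸m≡n spare empty ⟩
      empty                                          ≡⟨ sym (freeSites-blank (map not tgt) tgt (length-map not tgt)) ⟩
      freeSites (map not tgt) (blank tgt)            ≡⟨ sym (proj₂ (proj₂ phase₁-extends)) ⟩
      freeSites (map not tgt) lab₁                   ≡⟨ sym (freeSites-complement-fillWith tgt r lab₁) ⟩
      freeSites (map not tgt) (fillWith tgt r lab₁)  ∎

  genStep-result : genStep n (suc r) w tgt ≡ (map (fromMaybe 0) (fillWith (map not tgt) (r ∸ 1) (fillWith tgt r lab₁)) , acc₁)
  genStep-result = begin
    completed (twoPhases part anti (countTrue tgt) (sortDesc (zip (upTo n) w)) tgt)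
      ≡⟨ cong (λ order → completed (twoPhases part anti (countTrue tgt) order tgt)) (sortDesc-sites agree w-length) ⟩
    completed (twoPhases part anti (countTrue tgt) (balls ++ vacant) tgt)
      ≡⟨ cong (λ st → completed (foldl anti st (reverse (drop (countTrue tgt) (balls ++ vacant))))) particle-phase ⟩
    completed (foldl anti (fillWith tgt r lab₁ , acc₁) (reverse (drop (countTrue tgt) (balls ++ vacant))))
      ≡⟨ cong completed anti-phase ⟩
    (map (fromMaybe 0) (fillWith (map not tgt) (r ∸ 1) (fillWith tgt r lab₁)) , acc₁) ∎
    where
    part anti : Pairing
    part = genParticlePair n (suc r) w tgt
    anti = genAntiPair n (suc r) w tgt

  fmStep-result : fmStep n (suc r) src tgt ≡ (fmFill n (suc r) src tgt tgt lab₁ , acc₁)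
  fmStep-result = cong (λ st → (fmFill n (suc r) src tgt tgt (proj₁ st) , proj₂ st))
                       (foldl-cong (fmPair≗pairRight n (suc r) src tgt) (blank tgt , + 0) balls)

  labels-agree : Agreeing r (proj₁ (fmStep n (suc r) src tgt)) (proj₁ (genStep n (suc r) w tgt))
  labels-agree = subst₂ (λ fm gen → Agreeing r (proj₁ fm) (proj₁ gen)) (sym fmStep-result) (sym genStep-result)
                        (fmFill-agrees n r src tgt lab₁-onBalls)

  weights-agree : proj₂ (genStep n (suc r) w tgt) ≡ proj₂ (fmStep n (suc r) src tgt)
  weights-agree = trans (cong proj₂ genStep-result) (sym (cong proj₂ fmStep-result))

  balls-count : countJust (proj₁ (fmStep n (suc r) src tgt)) ≡ countTrue tgt
  balls-count = trans (cong (countJust ∘ proj₁) fmStep-result) (countJust-fmFill n r src tgt lab₁-onBalls)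

  labels-length : length (proj₁ (genStep n (suc r) w tgt)) ≡ n
  labels-length = begin
    length (proj₁ (genStep n (suc r) w tgt))
      ≡⟨ cong (length ∘ proj₁) genStep-result ⟩
    length (map (fromMaybe 0) (fillWith (map not tgt) (r ∸ 1) (fillWith tgt r lab₁)))
      ≡⟨ length-map (fromMaybe 0) (fillWith (map not tgt) (r ∸ 1) (fillWith tgt r lab₁)) ⟩
    length (fillWith (map not tgt) (r ∸ 1) (fillWith tgt r lab₁))
      ≡⟨ length-fillWith (map not tgt) (r ∸ 1) (fillWith tgt r lab₁) ⟩
    length (fillWith tgt r lab₁)
      ≡⟨ length-fillWith tgt r lab₁ ⟩
    length lab₁
      ≡⟨ trans length-lab₁ tgt-length ⟩
    n ∎

genGo≡fmGo : ∀ {n} rs src w rows {c} → Agreeing rs src w → countJust src ≡ c → Linked _≤_ (c ∷ map countTrue rows) →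
  length w ≡ n → All (λ t → length t ≡ n) rows → length rows < rs → genGo n rs w rows ≡ fmGo n rs src rows
genGo≡fmGo rs      src w []         _     _    _               _        _                  _           = refl
genGo≡fmGo (suc r) src w (t ∷ rows) agree refl (fits ∷ sizes) w-length (t-length ∷ lengths) (s≤s bound) =
  cong₂ ℤ._+_ weights-agree
    (genGo≡fmGo r _ _ rows labels-agree balls-count sizes labels-length lengths bound)
  where open OneRow _ r src w t agree w-length t-length fits

conjPart-antitone : ∀ p r → conjPart p (suc r) ≤ conjPart p r
conjPart-antitone p r = length-mono-≤ (filter⁺ (λ x → suc r ≤? x) (λ x → r ≤? x) (λ { refl → ≤⇒pred≤ }) (⊆-refl {x = parts p}))

map-countTrue-rowsOf : ∀ {n m} (M : Vec (Subset n) m) (f : ℕ → ℕ) → (∀ i → ∣ Vec.lookup M i ∣ ≡ f (toℕ i)) →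
  map countTrue (rowsOf M) ≡ applyUpTo f m
map-countTrue-rowsOf Vec.[]      f sizes = refl
map-countTrue-rowsOf (x Vec.∷ M) f sizes =
  cong₂ _∷_ (trans (countTrue-toList x) (sizes Fin.zero)) (map-countTrue-rowsOf M (f ∘ suc) (sizes ∘ Fin.suc))

rowsOf-lengths : ∀ {n m} (M : Vec (Subset n) m) → All (λ t → length t ≡ n) (rowsOf M)
rowsOf-lengths Vec.[]      = []
rowsOf-lengths (x Vec.∷ M) = length-toList x ∷ rowsOf-lengths M

IsMLQ-rowsTopDown : ∀ p n (M : Vec (Subset n) (largestPart p)) → IsMLQ p n M →
  length (reverse (rowsOf M)) ≡ largestPart p × All (λ t → length t ≡ n) (reverse (rowsOf M)) ×
  Linked _≤_ (map countTrue (reverse (rowsOf M)))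
IsMLQ-rowsTopDown p n M mlq =
  trans (length-reverse (rowsOf M)) (length-toList (Vec.map Vec.toList M)) ,
  All-reverse (rowsOf-lengths M) ,
  subst (Linked _≤_) (sym sizes) (Linked.applyDownFrom⁺₂ (conjPart p ∘ suc) (largestPart p) (λ i → conjPart-antitone p (suc i)))
  where
  open ≡-Reasoning
  sizes : map countTrue (reverse (rowsOf M)) ≡ applyDownFrom (conjPart p ∘ suc) (largestPart p)
  sizes = begin
    map countTrue (reverse (rowsOf M))                     ≡⟨ reverse-map countTrue (rowsOf M) ⟩
    reverse (map countTrue (rowsOf M))                     ≡⟨ cong reverse (map-countTrue-rowsOf M (conjPart p ∘ suc) mlq) ⟩
    reverse (applyUpTo (conjPart p ∘ suc) (largestPart p)) ≡⟨ reverse-applyUpTo (conjPart p ∘ suc) (largestPart p) ⟩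
    applyDownFrom (conjPart p ∘ suc) (largestPart p)       ∎

topLabels : ℕ → List Bool → Labels
topLabels L = map (λ b → if b then just L else nothing)

topGenLabels : ℕ → List Bool → List ℕ
topGenLabels L = map (λ b → if b then L else L ∸ 1)

topLabels-agree : ∀ L top → Agreeing L (topLabels L top) (topGenLabels L top)
topLabels-agree L []           = []
topLabels-agree L (true ∷ bs)  = (refl , ≤-refl) ∷ topLabels-agree L bs
topLabels-agree L (false ∷ bs) = refl ∷ topLabels-agree L bs

countJust-topLabels : ∀ L top → countJust (topLabels L top) ≡ countTrue top
countJust-topLabels L []           = refl
countJust-topLabels L (true ∷ bs)  = cong suc (countJust-topLabels L bs)
countJust-topLabels L (false ∷ bs) = countJust-topLabels L bs

lemma4p30 : (p : Partition) (n : ℕ) (M : Vec (Subset n) (largestPart p)) →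
    IsMLQ p n M → majG M ≡ maj M
lemma4p30 p n M mlq with reverse (rowsOf M) | IsMLQ-rowsTopDown p n M mlq
... | []         | _ = refl
... | top ∷ rows | rows-count , top-length ∷ lengths , sizes =
  genGo≡fmGo (largestPart p) (topLabels (largestPart p) top) (topGenLabels (largestPart p) top) rows
    (topLabels-agree (largestPart p) top) (countJust-topLabels (largestPart p) top) sizes
    (trans (length-map _ top) top-length) lengths (≤-reflexive rows-count)
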